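{- Let $G$ be a subgraph of a Cartesian product $\Gamma=G_1\square\cdots\square G_m$ of finite connected graphs. Then $\mathrm{vcd}(G)\le\mathrm{vcd}^*(G)$ and $\mathrm{vcdens}(G)\le\mathrm{vcdens}^*(G)$, all computed with respect to $\Gamma$.
   Context: All graphs finite, simple, undirected. The Cartesian product has vertex set $V(G_1)\times\cdots\times V(G_m)$, two tuples adjacent iff they differ in exactly one coordinate $j$ where they are adjacent in $G_j$. For a graph $F$, $\mathrm{dens}(F)=\max |E(F')|/|V(F')|$ over subgraphs $F'$ of $F$. A factor is non-trivial if it has at least two vertices. Subproducts: a subproduct of $\Gamma$ is $\Gamma'=G'_{i_1}\square\cdots\square G'_{i_k}$ with $i_1<\cdots<i_k$ and each $G'_{i_j}$ a connected subgraph of $G_{i_j}$ with at least two vertices; it is shattered by $G$ if for every vertex $(v'_{i_1},\ldots,v'_{i_k})$ of $\Gamma'$ there is a vertex $x$ of $G$ with $x_{i_j}=v'_{i_j}$ for all $j$. $\mathrm{vcd}(G)$ is the largest $k$ (number of factors) of a subproduct shattered by $G$, and $\mathrm{vcdens}(G)$ is the largest $\mathrm{dens}(\Gamma')$ of a subproduct $\Gamma'$ shattered by $G$. Minor-subproducts: for each $i$, let $\mathcal P_i=\{P^i_1,\ldots,P^i_{t_i}\}$ be a partition of $V(G_i)$ into sets inducing connected subgraphs of $G_i$, and $M_i$ a graph on vertex set $\mathcal P_i$ such that parts adjacent in $M_i$ are joined by an edge of $G_i$; $M=M_1\square\cdots\square M_m$ is a minor-subproduct, shattered by $G$ if each set $P^1_{l_1}\times\cdots\times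 P^m_{l_m}$ contains a vertex of $G$. $\mathrm{vcd}^*(G)$ is the largest number of non-trivial factors of a minor-subproduct shattered by $G$, and $\mathrm{vcdens}^*(G)$ is the largest $\mathrm{dens}(M)$ of a minor-subproduct $M$ shattered by $G$. -}

module Defs where

open import Data.Nat using (ℕ; _≤_; _<_; _*_; _≤?_)
open import Data.Fin using (Fin)
import Data.Fin as F
open import Data.Bool using (Bool; T)
open import Data.Product using (Σ; _×_; proj₁; proj₂; _,_)
open import Data.Sum using (_⊎_)
open import Data.List using (List; length; filter; allFin)
open import Data.List.Relation.Unary.All using (All)
open import Data.List.Relation.Unary.Any using (Any)
open import Data.List.Relation.Unary.AllPairs using (AllPairs)
open import Relation.Nullary using (¬_)
open import Relation.Binary.PropositionalEquality using (_≡_; _≢_)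
open import Relation.Binary.Construct.Closure.ReflexiveTransitive using (Star)

record Graph : Set where
  field
    n     : ℕ
    adj   : Fin n → Fin n → Bool
    sym   : ∀ u v → T (adj u v) → T (adj v u)
    irrefl : ∀ u → ¬ T (adj u u)
open Graph public

Connected : Graph → Set
Connected G = ∀ u v → Star (λ a b → T (adj G a b)) u v

record Factor : Set₁ where
  field
    V : Set
    E : V → V → Set

ProdV : ∀ {k} → (Fin k → Factor) → Set
ProdV H = ∀ j → Factor.V (H j)

_≈_ : ∀ {k} {H : Fin k → Factor} → ProdV H → ProdV H → Set
x ≈ y = ∀ j → x j ≡ y j

ProdAdj : ∀ {k} (H : Fin k → Factor) → ProdV H → ProdV H → Set
ProdAdj {k} H x y =
  Σ (Fin k) λ j → Factor.E (H j) (x j) (y j) × (∀ j' → j' ≢ j → x j' ≡ y j')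

SameEdge : ∀ {k} {H : Fin k → Factor} → ProdV H × ProdV H → ProdV H × ProdV H → Set
SameEdge {H = H} (x , y) (u , v) =
  (_≈_ {H = H} x u × _≈_ {H = H} y v) ⊎ (_≈_ {H = H} x v × _≈_ {H = H} y u)

record FinSub {k} (H : Fin k → Factor) : Set where
  field
    vs : List (ProdV H)
    es : List (ProdV H × ProdV H)
    vs-distinct : AllPairs (λ x y → ¬ (_≈_ {H = H} x y)) vs
    vs-nonempty : 0 < length vs
    es-adj : All (λ e → ProdAdj H (proj₁ e) (proj₂ e)) es
    es-in : All (λ e → Any (λ x → _≈_ {H = H} (proj₁ e) x) vs
                     × Any (λ x → _≈_ {H = H} (proj₂ e) x) vs) es
    es-distinct : AllPairs (λ e f → ¬ SameEdge {H = H} e f) es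

nV : ∀ {k} {H : Fin k → Factor} → FinSub H → ℕ
nV F = length (FinSub.vs F)

nE : ∀ {k} {H : Fin k → Factor} → FinSub H → ℕ
nE F = length (FinSub.es F)

graphFactor : Graph → Factor
graphFactor G = record { V = Fin (n G) ; E = λ a b → T (adj G a b) }

ΓV : ∀ {m} → (Fin m → Graph) → Set
ΓV Gs = ProdV (λ i → graphFactor (Gs i))

ΓAdj : ∀ {m} (Gs : Fin m → Graph) → ΓV Gs → ΓV Gs → Set
ΓAdj Gs = ProdAdj (λ i → graphFactor (Gs i))

record SubgraphOfProduct {m} (Gs : Fin m → Graph) : Set₁ where
  field
    VG : ΓV Gs → Set
    EG : ΓV Gs → ΓV Gs → Set
    EG-sub : ∀ x y → EG x y → ΓAdj Gs x y × VG x × VG y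
    EG-sym : ∀ x y → EG x y → EG y x

record Subproduct {m} (Gs : Fin m → Graph) : Set where
  field
    k    : ℕ
    idx  : Fin k → Fin m
    idx-incr : ∀ a b → a F.< b → idx a F.< idx b
    inV  : (j : Fin k) → Fin (n (Gs (idx j))) → Bool
    inE  : (j : Fin k) → Fin (n (Gs (idx j))) → Fin (n (Gs (idx j))) → Bool
    inE-sub : ∀ j u v → T (inE j u v) →
              T (adj (Gs (idx j)) u v) × T (inV j u) × T (inV j v)
    inE-sym : ∀ j u v → T (inE j u v) → T (inE j v u)
    connected : ∀ j u v → T (inV j u) → T (inV j v) →
                Star (λ a b → T (inE j a b)) u v
    two-vertices : ∀ j → Σ (Fin (n (Gs (idx j)))) λ u →
                         Σ (Fin (n (Gs (idx j)))) λ v →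
                         u ≢ v × T (inV j u) × T (inV j v)

spFactors : ∀ {m} {Gs : Fin m → Graph} (S : Subproduct Gs) →
            Fin (Subproduct.k S) → Factor
spFactors S j = record
  { V = Σ (Fin _) (λ u → T (inV j u))
  ; E = λ a b → T (inE j (proj₁ a) (proj₁ b)) }
  where open Subproduct S

ShatteredSP : ∀ {m} {Gs : Fin m → Graph} → SubgraphOfProduct Gs → Subproduct Gs → Set
ShatteredSP {Gs = Gs} G S =
  (w : ProdV (spFactors S)) →
  Σ (ΓV Gs) λ x → SubgraphOfProduct.VG G x ×
    (∀ j → x (Subproduct.idx S j) ≡ proj₁ (w j))

record MinorSubproduct {m} (Gs : Fin m → Graph) : Set where
  field
    t    : Fin m → ℕ
    part : (i : Fin m) → Fin (n (Gs i)) → Fin (t i)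
    part-nonempty : ∀ i p → Σ (Fin (n (Gs i))) λ u → part i u ≡ p
    part-connected : ∀ i u v → part i u ≡ part i v →
      Star (λ a b → T (adj (Gs i) a b) × part i a ≡ part i u × part i b ≡ part i u) u v
    madj : (i : Fin m) → Fin (t i) → Fin (t i) → Bool
    madj-sym : ∀ i p q → T (madj i p q) → T (madj i q p)
    madj-irrefl : ∀ i p → ¬ T (madj i p p)
    madj-realised : ∀ i p q → T (madj i p q) →
      Σ (Fin (n (Gs i))) λ u → Σ (Fin (n (Gs i))) λ v →
        part i u ≡ p × part i v ≡ q × T (adj (Gs i) u v)

msFactors : ∀ {m} {Gs : Fin m → Graph} (M : MinorSubproduct Gs) → Fin m → Factor
msFactors M i = record { V = Fin (t i) ; E = λ p q → T (madj i p q) }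
  where open MinorSubproduct M

ShatteredMS : ∀ {m} {Gs : Fin m → Graph} → SubgraphOfProduct Gs → MinorSubproduct Gs → Set
ShatteredMS {Gs = Gs} G M =
  (l : ProdV (msFactors M)) →
  Σ (ΓV Gs) λ x → SubgraphOfProduct.VG G x ×
    (∀ i → MinorSubproduct.part M i (x i) ≡ l i)

nontrivial : ∀ {m} {Gs : Fin m → Graph} → MinorSubproduct Gs → ℕ
nontrivial {m} M = length (filter (λ i → 2 ≤? MinorSubproduct.t M i) (allFin m))

module Submission where

-- Let Γ' = G'_{i_1} □ ⋯ □ G'_{i_k} be a subproduct
-- shattered by G.  In every factor G_i of Γ choose a non-empty "patch" U_i ⊆ V(G_i):
-- the vertex set of G'_{i_j} when i = i_j, and a single base vertex x₀ᵢ of G otherwise.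
-- Because G_i is connected, V(G_i) retracts onto U_i with connected fibres; the fibres
-- form a partition of V(G_i) into connected parts, one per vertex of U_i, and taking the
-- edges of G'_{i_j} between the parts yields a minor-subproduct M = M_1 □ ⋯ □ M_m with
-- M_{i_j} ≅ G'_{i_j} and all other factors trivial.  A tuple of parts of M is hit by G
-- because the corresponding tuple of Γ' is; so M is shattered and has ≥ k non-trivial
-- factors, giving vcd ≤ vcd*.  Moreover Γ' embeds into M, and the image of any finite
-- subgraph F of Γ' is a subgraph of M with the same numbers of vertices and edges, giving
-- vcdens ≤ vcdens*.

open import Defs renaming (sym to adj-sym)
open import Data.Nat using (ℕ; zero; suc; _≤_; _<_; _*_; _≤?_; _≤′_; z≤n; s≤s; ≤′-reflexive; ≤′-step)
open import Data.Nat.Properties using (≤-total; ≤-reflexive; ≤⇒≤′)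
open import Data.Fin using (Fin; zero; suc)
import Data.Fin as F
import Data.Fin.Properties as FP
open import Data.Bool using (Bool; true; false; T; if_then_else_)
open import Data.Bool.Properties using (T-irrelevant; T?; T-≡)
open import Data.Maybe using (Maybe; just; nothing; _<∣>_)
open import Data.Maybe.Properties using (just-injective)
open import Data.Product using (Σ; ∃; ∃₂; _×_; proj₁; proj₂; _,_)
open import Data.Sum using (inj₁; inj₂)
open import Data.Empty using (⊥-elim)
open import Data.List using (List; length; filter; allFin; lookup; map)
open import Data.List.Properties using (length-map)
open import Data.List.Membership.Propositional using (_∈_)
open import Data.List.Membership.Propositional.Properties using (∈-filter⁺; ∈-filter⁻; ∈-lookup; ∈-allFin)
import Data.List.Membership.Setoid.Properties as SetoidMembership
open import Data.List.Relation.Unary.Any using (index)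
import Data.List.Relation.Unary.Any as Any
open import Data.List.Relation.Unary.Any.Properties using (lookup-index)
import Data.List.Relation.Unary.Any.Properties as AnyP
import Data.List.Relation.Unary.All as All
import Data.List.Relation.Unary.All.Properties as AllP
open import Data.List.Relation.Unary.AllPairs using (_∷_)
import Data.List.Relation.Unary.AllPairs as AllPairs
import Data.List.Relation.Unary.AllPairs.Properties as AllPairsP
open import Data.List.Relation.Unary.Unique.Propositional using (Unique)
import Data.List.Relation.Unary.Unique.Propositional.Properties as UniqueP
open import Function using (_∘_)
open import Function.Bundles using (Equivalence)
open import Relation.Nullary using (Dec; yes; no; ¬_)
open import Relation.Nullary.Decidable using (⌊_⌋; fromWitness; toWitness)
open import Relation.Unary using (Decidable)
open import Relation.Binary.Definitions using (tri<; tri≈; tri>)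
open import Relation.Binary.PropositionalEquality
open import Relation.Binary.Construct.Closure.ReflexiveTransitive using (Star; ε; _◅_; _◅◅_)
import Relation.Binary.Construct.Closure.ReflexiveTransitive as Star
open import Axiom.UniquenessOfIdentityProofs using (module Decidable⇒UIP)

lookup-injective : ∀ {A : Set} {xs : List A} → Unique xs →
                   ∀ i j → lookup xs i ≡ lookup xs j → i ≡ j
lookup-injective (_ ∷ _) zero zero _ = refl
lookup-injective (x∉xs ∷ _) zero (suc j) x≡ = ⊥-elim (All.lookup x∉xs (∈-lookup j) x≡)
lookup-injective (x∉xs ∷ _) (suc i) zero ≡x = ⊥-elim (All.lookup x∉xs (∈-lookup i) (sym ≡x))
lookup-injective (_ ∷ u) (suc i) (suc j) eq = cong suc (lookup-injective u i j eq)

injection-into-filter : ∀ {k m} {P : Fin m → Set} (P? : Decidable P)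
  (f : Fin k → Fin m) → (∀ a b → f a ≡ f b → a ≡ b) → (∀ j → P (f j)) →
  k ≤ length (filter P? (allFin m))
injection-into-filter P? f f-inj Pf = FP.injective⇒≤ ι-injective
  where
  member : ∀ j → f j ∈ filter P? (allFin _)
  member j = ∈-filter⁺ P? (∈-allFin (f j)) (Pf j)
  ι : Fin _ → Fin (length (filter P? (allFin _)))
  ι j = index (member j)
  ι-injective : ∀ {a b} → ι a ≡ ι b → a ≡ b
  ι-injective {a} {b} eq =
    f-inj a b (SetoidMembership.index-injective (setoid (Fin _)) (member a) (member b) eq)

distinct⇒two≤ : ∀ {t} (p q : Fin t) → p ≢ q → 2 ≤ t
distinct⇒two≤ {suc zero} zero zero p≢q = ⊥-elim (p≢q refl)
distinct⇒two≤ {suc (suc t)} _ _ _ = s≤s (s≤s z≤n)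

firstJust : ∀ {A : Set} {n} → (Fin n → Maybe A) → Maybe A
firstJust {n = zero} g = nothing
firstJust {n = suc n} g = g zero <∣> firstJust (g ∘ suc)

firstJust-sound : ∀ {A : Set} {n} (g : Fin n → Maybe A) {a} →
                  firstJust g ≡ just a → ∃ λ w → g w ≡ just a
firstJust-sound {n = suc n} g eq with g zero in g0
... | just b = zero , trans g0 eq
... | nothing = let (w , gw) = firstJust-sound (g ∘ suc) eq in suc w , gw

firstJust-complete : ∀ {A : Set} {n} (g : Fin n → Maybe A) w {b} →
                     g w ≡ just b → ∃ λ a → firstJust g ≡ just a
firstJust-complete {n = suc n} g w gw with g zero in g0
... | just c = c , refl
firstJust-complete g zero gw | nothing with () ← trans (sym g0) gw
firstJust-complete g (suc w) gw | nothing = firstJust-complete (g ∘ suc) w gw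

module Enumeration {n : ℕ} (U : Fin n → Bool) where
  U? : Decidable (λ u → T (U u))
  U? u = T? (U u)

  members : List (Fin n)
  members = filter U? (allFin n)

  size : ℕ
  size = length members

  decode : Fin size → Fin n
  decode = lookup members

  decode-member : ∀ p → T (U (decode p))
  decode-member p = proj₂ (∈-filter⁻ U? {xs = allFin n} (∈-lookup p))

  decode-injective : ∀ p q → decode p ≡ decode q → p ≡ q
  decode-injective = lookup-injective (UniqueP.filter⁺ U? (UniqueP.allFin⁺ n))

  listed : ∀ u → T (U u) → u ∈ members
  listed u u∈U = ∈-filter⁺ U? (∈-allFin u) u∈U

  encode : (u : Fin n) → T (U u) → Fin size
  encode u u∈U = index (listed u u∈U)

  decode-encode : ∀ u u∈U → decode (encode u u∈U) ≡ u
  decode-encode u u∈U = sym (lookup-index (listed u u∈U))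

  encode-decode : ∀ p p∈U → encode (decode p) p∈U ≡ p
  encode-decode p p∈U = decode-injective _ _ (decode-encode (decode p) p∈U)

  encode-cong : ∀ {u v} u∈U v∈U → u ≡ v → encode u u∈U ≡ encode v v∈U
  encode-cong u∈U v∈U refl = cong (encode _) (T-irrelevant u∈U v∈U)

  encode-injective : ∀ {u v} u∈U v∈U → encode u u∈U ≡ encode v v∈U → u ≡ v
  encode-injective {u} {v} u∈U v∈U eq = begin
    u                     ≡⟨ decode-encode u u∈U ⟨
    decode (encode u u∈U) ≡⟨ cong decode eq ⟩
    decode (encode v v∈U) ≡⟨ decode-encode v v∈U ⟩
    v                     ∎
    where open ≡-Reasoning

-- In a connected graph H every non-empty decidable vertex set U
-- is the image of a retraction r : V(H) → U whose fibres induce connected subgraphs.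
-- r(v) is the vertex found by a greedy search: `search k v` succeeds at once if v ∈ U,
-- and otherwise asks the first neighbour whose search of depth k - 1 succeeds.  Once a
-- search succeeds, deeper searches agree with it, so r is independent of the depth, and
-- the search route from v to r(v) runs inside the fibre of r(v).
module Retraction (H : Graph) (connected : Connected H)
                  (U : Fin (n H) → Bool) (u₀ : Fin (n H)) (u₀∈U : T (U u₀)) where
  Vertex : Set
  Vertex = Fin (n H)

  Adj : Vertex → Vertex → Set
  Adj a b = T (adj H a b)

  search : ℕ → Vertex → Maybe Vertex
  search zero v = if U v then just v else nothing
  search (suc k) v = search k v <∣> firstJust (λ w → if adj H v w then search k w else nothing)

  via-neighbours : ℕ → Vertex → Fin (n H) → Maybe Vertex
  via-neighbours k v w = if adj H v w then search k w else nothing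

  search-step : ∀ k v {a} → search k v ≡ just a → search (suc k) v ≡ just a
  search-step k v found rewrite found = refl

  search-at-U : ∀ u → T (U u) → search 0 u ≡ just u
  search-at-U u u∈U = cong (λ b → if b then just u else nothing) (Equivalence.to T-≡ u∈U)

  search-mono : ∀ {k k'} v {a} → k ≤′ k' → search k v ≡ just a → search k' v ≡ just a
  search-mono v (≤′-reflexive refl) found = found
  search-mono v (≤′-step {n = k'} k≤k') found = search-step k' v (search-mono v k≤k' found)

  search-succeeds : ∀ {v} → Star Adj v u₀ → ∃₂ λ k a → search k v ≡ just a
  search-succeeds ε = 0 , u₀ , search-at-U u₀ u₀∈U
  search-succeeds {v} (_◅_ {j = w} v~w path) with search-succeeds path
  ... | k , b , found-w with search k v in found-k
  ...   | just a = suc k , a , search-step k v found-k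
  ...   | nothing =
    let (a , first) = firstJust-complete (via-neighbours k v) w step-to-w
    in suc k , a , trans (cong (_<∣> firstJust (via-neighbours k v)) found-k) first
    where
    step-to-w : via-neighbours k v w ≡ just b
    step-to-w rewrite Equivalence.to T-≡ v~w = found-w

  depth : Vertex → ℕ
  depth v = proj₁ (search-succeeds (connected v u₀))

  r : Vertex → Vertex
  r v = proj₁ (proj₂ (search-succeeds (connected v u₀)))

  search-finds-r : ∀ v → search (depth v) v ≡ just (r v)
  search-finds-r v = proj₂ (proj₂ (search-succeeds (connected v u₀)))

  search-returns-r : ∀ k v {a} → search k v ≡ just a → r v ≡ a
  search-returns-r k v found with ≤-total k (depth v)
  ... | inj₁ k≤d = just-injective (trans (sym (search-finds-r v)) (search-mono v (≤⇒≤′ k≤d) found))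
  ... | inj₂ d≤k = just-injective (trans (sym (search-mono v (≤⇒≤′ d≤k) (search-finds-r v))) found)

  search-in-U : ∀ k v {a} → search k v ≡ just a → T (U a)
  search-in-U zero v found with U v in v∈U
  search-in-U zero v refl | true = subst T (sym v∈U) _
  search-in-U (suc k) v found with search k v in found-k
  ... | just b = search-in-U k v (trans found-k found)
  ... | nothing with firstJust-sound (via-neighbours k v) found
  ...   | w , found-w with adj H v w
  ...     | true = search-in-U k w found-w

  search-route : ∀ k v {a} → search k v ≡ just a →
                 Star (λ x y → Adj x y × r x ≡ a × r y ≡ a) v a
  search-route zero v found with U v
  search-route zero v refl | true = ε
  search-route (suc k) v found with search k v in found-k
  search-route (suc k) v refl | just b = search-route k v found-k
  ... | nothing with firstJust-sound (via-neighbours k v) found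
  ...   | w , found-w with adj H v w in v~w
  ...     | true = (subst T (sym v~w) _ , search-returns-r (suc k) v found-v , search-returns-r k w found-w)
                   ◅ search-route k w found-w
    where
    found-v : search (suc k) v ≡ just _
    found-v = trans (cong (_<∣> firstJust (via-neighbours k v)) found-k) found

  r-in-U : ∀ v → T (U (r v))
  r-in-U v = search-in-U (depth v) v (search-finds-r v)

  r-fixes-U : ∀ u → T (U u) → r u ≡ u
  r-fixes-U u u∈U = search-returns-r zero u (search-at-U u u∈U)

  fibre-connected : ∀ u v → r u ≡ r v → Star (λ a b → Adj a b × r a ≡ r u × r b ≡ r u) u v
  fibre-connected u v same = route u refl ◅◅ Star.reverse flip (route v (sym same))
    where
    route : ∀ x → r x ≡ r u → Star (λ a b → Adj a b × r a ≡ r u × r b ≡ r u) x (r u)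
    route x rx≡ru = subst (Star _ x) rx≡ru
      (Star.map (λ (x~y , p , q) → x~y , trans p rx≡ru , trans q rx≡ru)
                (search-route (depth x) x (search-finds-r x)))
    flip : ∀ {x y} → Adj x y × r x ≡ r u × r y ≡ r u → Adj y x × r y ≡ r u × r x ≡ r u
    flip (x~y , p , q) = adj-sym H _ _ x~y , q , p

module Image {k k'} {H : Fin k → Factor} {H' : Fin k' → Factor}
  (φ : ProdV H → ProdV H')
  (φ-cong : ∀ {a b} → _≈_ {H = H} a b → _≈_ {H = H'} (φ a) (φ b))
  (φ-reflects : ∀ {a b} → _≈_ {H = H'} (φ a) (φ b) → _≈_ {H = H} a b)
  (φ-adj : ∀ {a b} → ProdAdj H a b → ProdAdj H' (φ a) (φ b)) where

  φ² : ProdV H × ProdV H → ProdV H' × ProdV H'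
  φ² (a , b) = φ a , φ b

  reflects-same-edge : ∀ {e f} → SameEdge {H = H'} (φ² e) (φ² f) → SameEdge {H = H} e f
  reflects-same-edge (inj₁ (p , q)) = inj₁ (φ-reflects p , φ-reflects q)
  reflects-same-edge (inj₂ (p , q)) = inj₂ (φ-reflects p , φ-reflects q)

  image : FinSub H → FinSub H'
  image F = record
    { vs = map φ vs
    ; es = map φ² es
    ; vs-distinct = AllPairsP.map⁺ (AllPairs.map (λ a≉b → a≉b ∘ φ-reflects) vs-distinct)
    ; vs-nonempty = subst (0 <_) (sym (length-map φ vs)) vs-nonempty
    ; es-adj = AllP.map⁺ (All.map φ-adj es-adj)
    ; es-in = AllP.map⁺ (All.map (λ (a∈ , b∈) → AnyP.map⁺ (Any.map φ-cong a∈) ,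
                                                 AnyP.map⁺ (Any.map φ-cong b∈)) es-in)
    ; es-distinct = AllPairsP.map⁺ (AllPairs.map (λ e≠f → e≠f ∘ reflects-same-edge) es-distinct)
    }
    where open FinSub F

  image-density : ∀ F → nE F * nV (image F) ≤ nE (image F) * nV F
  image-density F = ≤-reflexive (begin
    nE F * nV (image F) ≡⟨ cong (nE F *_) (length-map φ (FinSub.vs F)) ⟩
    nE F * nV F         ≡⟨ cong (_* nV F) (length-map φ² (FinSub.es F)) ⟨
    nE (image F) * nV F ∎)
    where open ≡-Reasoning

record Patch (H : Graph) : Set where
  field
    U : Fin (n H) → Bool
    E : Fin (n H) → Fin (n H) → Bool
    anchor : Fin (n H)
    anchor∈U : T (U anchor)
    E⊆adj : ∀ u v → T (E u v) → T (adj H u v)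
    E-sym : ∀ u v → T (E u v) → T (E v u)

pointPatch : ∀ {H : Graph} → Fin (n H) → Patch H
pointPatch x = record
  { U = λ u → ⌊ u F.≟ x ⌋ ; E = λ _ _ → false ; anchor = x ; anchor∈U = fromWitness refl
  ; E⊆adj = λ _ _ () ; E-sym = λ _ _ () }

module Contraction {m} (Gs : Fin m → Graph) (connected : ∀ i → Connected (Gs i))
                   (patch : ∀ i → Patch (Gs i)) where
  open Patch
  module Enum (i : Fin m) = Enumeration (U (patch i))
  module Ret (i : Fin m) = Retraction (Gs i) (connected i) (U (patch i))
                                      (anchor (patch i)) (anchor∈U (patch i))
  open Enum using (encode; decode)

  part : (i : Fin m) → Fin (n (Gs i)) → Fin (Enum.size i)
  part i u = encode i (Ret.r i u) (Ret.r-in-U i u)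

  part-on-U : ∀ i u (u∈U : T (U (patch i) u)) → part i u ≡ encode i u u∈U
  part-on-U i u u∈U = Enum.encode-cong i _ _ (Ret.r-fixes-U i u u∈U)

  part-decode : ∀ i p → part i (decode i p) ≡ p
  part-decode i p = trans (part-on-U i _ (Enum.decode-member i p)) (Enum.encode-decode i p _)

  same-part⇒same-r : ∀ i u v → part i u ≡ part i v → Ret.r i u ≡ Ret.r i v
  same-part⇒same-r i u v = Enum.encode-injective i _ _

  part-injective-on-U : ∀ i {u v} → T (U (patch i) u) → T (U (patch i) v) →
                        part i u ≡ part i v → u ≡ v
  part-injective-on-U i {u} {v} u∈U v∈U same =
    trans (sym (Ret.r-fixes-U i u u∈U)) (trans (same-part⇒same-r i u v same) (Ret.r-fixes-U i v v∈U))

  madj : (i : Fin m) → Fin (Enum.size i) → Fin (Enum.size i) → Bool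
  madj i p q = E (patch i) (decode i p) (decode i q)

  contracted : MinorSubproduct Gs
  contracted = record
    { t = Enum.size
    ; part = part
    ; part-nonempty = λ i p → decode i p , part-decode i p
    ; part-connected = λ i u v same →
        Star.map (λ (u~v , p , q) → u~v , cong-part i p , cong-part i q)
                 (Ret.fibre-connected i u v (same-part⇒same-r i u v same))
    ; madj = madj
    ; madj-sym = λ i p q → E-sym (patch i) _ _
    ; madj-irrefl = λ i p p~p → irrefl (Gs i) _ (E⊆adj (patch i) _ _ p~p)
    ; madj-realised = λ i p q p~q →
        decode i p , decode i q , part-decode i p , part-decode i q , E⊆adj (patch i) _ _ p~q
    }
    where
    cong-part : ∀ i {a b} → Ret.r i a ≡ Ret.r i b → part i a ≡ part i b
    cong-part i = Enum.encode-cong i _ _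

  patch-edge : ∀ i {u v} → T (U (patch i) u) → T (U (patch i) v) →
               T (E (patch i) u v) → T (madj i (part i u) (part i v))
  patch-edge i {u} {v} u∈U v∈U u~v =
    subst₂ (λ x y → T (E (patch i) x y))
      (sym (trans (cong (decode i) (part-on-U i u u∈U)) (Enum.decode-encode i u u∈U)))
      (sym (trans (cong (decode i) (part-on-U i v v∈U)) (Enum.decode-encode i v v∈U)))
      u~v

  single-part : ∀ i → (∀ u v → T (U (patch i) u) → T (U (patch i) v) → u ≡ v) →
                (p q : Fin (Enum.size i)) → p ≡ q
  single-part i subsingleton p q =
    Enum.decode-injective i p q (subsingleton _ _ (Enum.decode-member i p) (Enum.decode-member i q))

  two-parts : ∀ i {u v} → u ≢ v → T (U (patch i) u) → T (U (patch i) v) → 2 ≤ Enum.size i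
  two-parts i {u} {v} u≢v u∈U v∈U =
    distinct⇒two≤ (encode i u u∈U) (encode i v v∈U) (u≢v ∘ Enum.encode-injective i u∈U v∈U)

module FromSubproduct {m} (Gs : Fin m → Graph) (factors-connected : ∀ i → Connected (Gs i))
  (G : SubgraphOfProduct Gs) (S : Subproduct Gs) (shattered : ShatteredSP G S) where
  open Subproduct S

  idx-injective : ∀ a b → idx a ≡ idx b → a ≡ b
  idx-injective a b same with FP.<-cmp a b
  ... | tri< a<b _ _ = ⊥-elim (FP.<-irrefl same (idx-incr a b a<b))
  ... | tri≈ _ a≡b _ = a≡b
  ... | tri> _ _ b<a = ⊥-elim (FP.<-irrefl (sym same) (idx-incr b a b<a))

  Owner : Fin m → Set
  Owner i = Σ (Fin k) λ j → idx j ≡ i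

  owner : ∀ i → Dec (Owner i)
  owner i = FP.any? (λ j → idx j F.≟ i)

  owner-idx : ∀ j → owner (idx j) ≡ yes (j , refl)
  owner-idx j with owner (idx j)
  ... | no unowned = ⊥-elim (unowned (j , refl))
  ... | yes (j' , same) with idx-injective j' j same
  ...   | refl = cong (λ p → yes (j , p)) (Decidable⇒UIP.≡-irrelevant F._≟_ same refl)

  x₀ : ΓV Gs
  x₀ = proj₁ (shattered (λ j → let (u , _ , _ , u∈V , _) = two-vertices j in u , u∈V))

  factorPatch : ∀ j → Patch (Gs (idx j))
  factorPatch j = let (u , _ , _ , u∈V , _) = two-vertices j in record
    { U = inV j ; E = inE j ; anchor = u ; anchor∈U = u∈V
    ; E⊆adj = λ u v u~v → proj₁ (inE-sub j u v u~v) ; E-sym = inE-sym j }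

  patchAt : ∀ i → Dec (Owner i) → Patch (Gs i)
  patchAt .(idx j) (yes (j , refl)) = factorPatch j
  patchAt i (no _) = pointPatch (x₀ i)

  patch : ∀ i → Patch (Gs i)
  patch i = patchAt i (owner i)

  open Contraction Gs factors-connected patch public
  open Patch

  patch-idx : ∀ j → patch (idx j) ≡ factorPatch j
  patch-idx j = cong (patchAt (idx j)) (owner-idx j)

  toFactor : ∀ j {u} → T (U (patch (idx j)) u) → T (inV j u)
  toFactor j {u} = subst (λ P → T (U P u)) (patch-idx j)

  fromFactor : ∀ j {u} → T (inV j u) → T (U (patch (idx j)) u)
  fromFactor j {u} = subst (λ P → T (U P u)) (sym (patch-idx j))

  fromFactorEdge : ∀ j {u v} → T (inE j u v) → T (E (patch (idx j)) u v)
  fromFactorEdge j {u} {v} = subst (λ P → T (E P u v)) (sym (patch-idx j))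

  unowned-single : ∀ i → ¬ Owner i → ∀ u v → T (U (patch i) u) → T (U (patch i) v) → u ≡ v
  unowned-single i unowned u v with owner i
  ... | yes owned = ⊥-elim (unowned owned)
  ... | no _ = λ u≡ v≡ → trans (toWitness u≡) (sym (toWitness v≡))

  -- The contraction is shattered by G: a tuple of parts is hit by any vertex of G that
  -- realises the corresponding tuple of S (unowned coordinates have a single part).
  contracted-shattered : ShatteredMS G contracted
  contracted-shattered l = x , x∈G , λ i → hitsAt i (owner i)
    where
    w : ProdV (spFactors S)
    w j = Enum.decode (idx j) (l (idx j)) , toFactor j (Enum.decode-member (idx j) _)
    x : ΓV Gs
    x = proj₁ (shattered w)
    x∈G : SubgraphOfProduct.VG G x
    x∈G = proj₁ (proj₂ (shattered w))
    x-realises-w : ∀ j → x (idx j) ≡ proj₁ (w j)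
    x-realises-w = proj₂ (proj₂ (shattered w))
    hitsAt : ∀ i → Dec (Owner i) → part i (x i) ≡ l i
    hitsAt .(idx j) (yes (j , refl)) = trans (cong (part (idx j)) (x-realises-w j)) (part-decode _ _)
    hitsAt i (no unowned) = single-part i (unowned-single i unowned) _ _

  -- Every factor of S yields a distinct non-trivial factor of the contraction.
  contracted-nontrivial : k ≤ nontrivial contracted
  contracted-nontrivial = injection-into-filter (λ i → 2 ≤? Enum.size i) idx idx-injective two-at
    where
    two-at : ∀ j → 2 ≤ Enum.size (idx j)
    two-at j = let (u , v , u≢v , u∈V , v∈V) = two-vertices j
               in two-parts (idx j) u≢v (fromFactor j u∈V) (fromFactor j v∈V)

  liftAt : ProdV (spFactors S) → ∀ i → Dec (Owner i) → Fin (n (Gs i))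
  liftAt w .(idx j) (yes (j , refl)) = proj₁ (w j)
  liftAt w i (no _) = x₀ i

  lift : ProdV (spFactors S) → ΓV Gs
  lift w i = liftAt w i (owner i)

  lift-idx : ∀ w j → lift w (idx j) ≡ proj₁ (w j)
  lift-idx w j = cong (liftAt w (idx j)) (owner-idx j)

  lift-in-patch : ∀ w j → T (U (patch (idx j)) (lift w (idx j)))
  lift-in-patch w j = subst (λ u → T (U (patch (idx j)) u)) (sym (lift-idx w j)) (fromFactor j (proj₂ (w j)))

  liftAt-agree : ∀ {a b} i → (∀ j → idx j ≡ i → a j ≡ b j) → ∀ d → liftAt a i d ≡ liftAt b i d
  liftAt-agree .(idx j) agree (yes (j , refl)) = cong proj₁ (agree j refl)
  liftAt-agree i agree (no _) = refl

  embed : ProdV (spFactors S) → ProdV (msFactors contracted)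
  embed w i = part i (lift w i)

  embed-cong : ∀ {a b} → _≈_ {H = spFactors S} a b → _≈_ {H = msFactors contracted} (embed a) (embed b)
  embed-cong a≈b i = cong (part i) (liftAt-agree i (λ j _ → a≈b j) (owner i))

  embed-reflects : ∀ {a b} → _≈_ {H = msFactors contracted} (embed a) (embed b) → _≈_ {H = spFactors S} a b
  embed-reflects {a} {b} same j = member-≡ (begin
    proj₁ (a j)     ≡⟨ lift-idx a j ⟨
    lift a (idx j)  ≡⟨ part-injective-on-U (idx j) (lift-in-patch a j) (lift-in-patch b j) (same (idx j)) ⟩
    lift b (idx j)  ≡⟨ lift-idx b j ⟩
    proj₁ (b j)     ∎)
    where
    open ≡-Reasoning
    member-≡ : ∀ {u v : Factor.V (spFactors S j)} → proj₁ u ≡ proj₁ v → u ≡ v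
    member-≡ {u , u∈V} {.u , v∈V} refl = cong (u ,_) (T-irrelevant u∈V v∈V)

  embed-adj : ∀ {a b} → ProdAdj (spFactors S) a b → ProdAdj (msFactors contracted) (embed a) (embed b)
  embed-adj {a} {b} (j , a~b , same-elsewhere) = idx j , edge , elsewhere
    where
    edge : T (madj (idx j) (embed a (idx j)) (embed b (idx j)))
    edge = patch-edge (idx j) (lift-in-patch a j) (lift-in-patch b j)
      (subst₂ (λ u v → T (E (patch (idx j)) u v)) (sym (lift-idx a j)) (sym (lift-idx b j))
              (fromFactorEdge j a~b))
    elsewhere : ∀ i → i ≢ idx j → embed a i ≡ embed b i
    elsewhere i i≢idx = cong (part i) (liftAt-agree i
      (λ j' idx≡i → same-elsewhere j' (λ j'≡j → i≢idx (trans (sym idx≡i) (cong idx j'≡j)))) (owner i))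

  open Image {H = spFactors S} {H' = msFactors contracted} embed embed-cong embed-reflects embed-adj
    public using (image; image-density)

lemma6p1 : ∀ {m} (Gs : Fin m → Graph) → (∀ i → Connected (Gs i)) →
           (G : SubgraphOfProduct Gs) →
           ((S : Subproduct Gs) → ShatteredSP G S →
              Σ (MinorSubproduct Gs) λ M →
                ShatteredMS G M × Subproduct.k S ≤ nontrivial M)
           ×
           ((S : Subproduct Gs) → ShatteredSP G S → (F : FinSub (spFactors S)) →
              Σ (MinorSubproduct Gs) λ M →
                ShatteredMS G M × Σ (FinSub (msFactors M)) λ F' →
                  nE F * nV F' ≤ nE F' * nV F)
lemma6p1 Gs connected G =
  (λ S shattered → let open FromSubproduct Gs connected G S shattered in
     contracted , contracted-shattered , contracted-nontrivial) ,
  (λ S shattered F → let open FromSubproduct Gs connected G S shattered in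
     contracted , contracted-shattered , image F , image-density F)
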